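{- For every integer $n\geq 38$, there exists a simple connected graph on $n$ vertices which is not a tree and which is neutral, i.e. whose assortativity coefficient satisfies $r=0$.
   Context: For a simple connected graph $G=(V,E)$ with $m=|E|\geq 1$ edges, where $d_u$ is the degree of vertex $u$ and $e_{uv}$ denotes the edge with endpoints $u,v$, the assortativity coefficient is $$r=\frac{m^{ -1}\sum_{e_{uv}\in E} d_{u}d_{v}-\Big[m^{ -1}\sum_{e_{uv}\in E} \tfrac{1}{2}(d_{u}+d_{v})\Big]^{2}}{m^{ -1}\sum_{e_{uv}\in E} \tfrac{1}{2}(d^{2}_{u}+d^{2}_{v})-\Big[m^{ -1}\sum_{e_{uv}\in E} \tfrac{1}{2}(d_{u}+d_{v})\Big]^{2}}.$$ $G$ is called neutral if $r$ is well defined (nonzero denominator) and $r=0$. -}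

module Defs where

open import Data.Bool using (Bool; true; false; T; _∧_)
open import Data.Nat using (ℕ; zero; suc; _≤_; _<ᵇ_; NonZero)
open import Data.Fin using (Fin; toℕ)
open import Data.List using (List; []; _∷_; _++_; [_]; length; map; foldr; filterᵇ; cartesianProduct; allFin)
open import Data.List.Relation.Unary.Unique.Propositional using (Unique)
open import Data.Product using (Σ; _×_; _,_; proj₁; proj₂)
open import Data.Unit using (⊤)
open import Data.Integer using (+_)
open import Data.Rational using (ℚ; _/_; _+_; _*_; _-_; _÷_; ½; 0ℚ)
import Data.Rational as ℚ
open import Relation.Binary.PropositionalEquality using (_≡_)
open import Relation.Nullary using (¬_)

record Graph (n : ℕ) : Set where
  field
    adj   : Fin n → Fin n → Bool
    sym   : ∀ u v → adj u v ≡ adj v u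
    irrefl : ∀ u → adj u u ≡ false
open Graph public

module _ {n : ℕ} (G : Graph n) where

  data Walk : Fin n → Fin n → Set where
    here : ∀ {u} → Walk u u
    step : ∀ {u w v} → T (adj G u w) → Walk w v → Walk u v

  Connected : Set
  Connected = ∀ u v → Walk u v

  Chain : List (Fin n) → Set
  Chain []           = ⊤
  Chain (x ∷ [])     = ⊤
  Chain (x ∷ y ∷ xs) = T (adj G x y) × Chain (y ∷ xs)

  CyclicChain : List (Fin n) → Set
  CyclicChain []       = ⊤
  CyclicChain (x ∷ xs) = Chain ((x ∷ xs) ++ [ x ])

  Cycle : Set
  Cycle = Σ (List (Fin n)) λ vs → 3 ≤ length vs × Unique vs × CyclicChain vs

  Acyclic : Set
  Acyclic = ¬ Cycle

  IsTree : Set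
  IsTree = Connected × Acyclic

  deg : Fin n → ℕ
  deg u = length (filterᵇ (adj G u) (allFin n))

  -- the edge set: each edge e_uv listed once, as the pair (u , v) with u < v
  edges : List (Fin n × Fin n)
  edges = filterᵇ (λ p → adj G (proj₁ p) (proj₂ p) ∧ (toℕ (proj₁ p) <ᵇ toℕ (proj₂ p)))
                  (cartesianProduct (allFin n) (allFin n))

  size : ℕ
  size = length edges

  fromℕ : ℕ → ℚ
  fromℕ k = + k / 1

  sumE : (Fin n × Fin n → ℚ) → List (Fin n × Fin n) → ℚ
  sumE f = foldr (λ e acc → f e + acc) 0ℚ

  d : Fin n → ℚ
  d u = fromℕ (deg u)

  module _ .{{nzm : NonZero size}} where

    minv : ℚ
    minv = + 1 / size

    termA : ℚ
    termA = minv * sumE (λ e → d (proj₁ e) * d (proj₂ e)) edges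

    termB : ℚ
    termB = minv * sumE (λ e → ½ * (d (proj₁ e) + d (proj₂ e))) edges

    termC : ℚ
    termC = minv * sumE (λ e → ½ * (d (proj₁ e) * d (proj₁ e) + d (proj₂ e) * d (proj₂ e))) edges

    numer : ℚ
    numer = termA - termB * termB

    denom : ℚ
    denom = termC - termB * termB

    assortativity : .{{ℚ.NonZero denom}} → ℚ
    assortativity = numer ÷ denom

  Neutral : Set
  Neutral = Σ (NonZero size) λ nzm →
            Σ (ℚ.NonZero (denom {{nzm}})) λ nzd →
              assortativity {{nzm}} {{nzd}} ≡ 0ℚ

module Submission where

-- For k ≥ 2 beads and b ≤ k, the necklace graph has vertices a₀ … a₄ in every bead i: a 4-cycle
-- a₀ a₁ a₂ a₃, a vertex a₄ adjacent to a₀ and a₁, and an edge from a₄ to a₀ of bead i + 1 (mod k);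
-- the first b beads also carry a pendant vertex a₅ at a₃. It has n = 5k + b vertices, and every
-- n ≥ 38 has this form with k = ⌊n/5⌋, b = n mod 5. It is connected and contains the triangle
-- a₀ a₁ a₄. Adding up, bead by bead, the degree pairs at the ends of its m = 7k + b edges gives
-- Σ d_u d_v = 9m and Σ (d_u + d_v) = 6m: the degrees at the two ends of an edge have mean 3 and are
-- uncorrelated, so the numerator of r vanishes. But Σ (d_u² + d_v²) = 18m + 8k + 2b ≠ 18m, so
-- these degrees are not constant and the denominator of r does not vanish.

open import Defs hiding (sym)
open import Data.Bool using (Bool; true; false; T; T?; _∧_; _∨_)
open import Data.Bool.Properties using (T-∧; T-∨)
open import Data.Empty using (⊥-elim)
open import Data.Fin using (Fin; toℕ; fromℕ<)
open import Data.Fin.Properties using (toℕ-injective; toℕ-fromℕ<; fromℕ<-toℕ; fromℕ<-injective; toℕ<n)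
open import Data.List using (List; []; _∷_; _++_; map; length; filterᵇ; applyUpTo; allFin; tabulate; cartesianProduct)
open import Data.List.Properties using (map-++; filter-++; length-map; map-∘; map-cong; map-tabulate; applyUpTo-∷ʳ)
open import Data.List.Membership.Propositional using (_∈_; _∉_)
open import Data.List.Membership.Propositional.Properties
  using (∈-map⁺; ∈-map⁻; ∈-filter⁺; ∈-filter⁻; ∈-++⁺ˡ; ∈-++⁺ʳ; ∈-++⁻; ∈-cartesianProduct⁺; ∈-allFin)
open import Data.List.Membership.Propositional.Properties.WithK using (unique∧set⇒bag)
open import Data.List.Relation.Binary.BagAndSetEquality using (∼bag⇒↭)
open import Data.List.Relation.Binary.Permutation.Propositional using (_↭_)
open import Data.List.Relation.Binary.Permutation.Propositional.Properties using (↭-length) renaming (map⁺ to ↭-map⁺)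
open import Data.List.Relation.Unary.All as All using (All; []; _∷_)
open import Data.List.Relation.Unary.AllPairs using ([]; _∷_)
open import Data.List.Relation.Unary.Any using (here; there)
open import Data.List.Relation.Unary.Unique.Propositional using (Unique)
import Data.List.Relation.Unary.Unique.Propositional.Properties as Unique
open import Data.Nat using (ℕ; zero; suc; pred; NonZero; _≤_; _<_; _<ᵇ_; _≡ᵇ_; _∸_; _/_; _%_; s≤s; z≤n)
import Data.Nat as ℕ
import Data.Nat.Properties as ℕ
open import Data.Nat.DivMod
  using ( _mod_; %-distribˡ-+; m%n%n≡m%n; [m+n]%n≡m%n; [m+kn]%n≡m%n; m<n⇒m%n≡m; n%n≡0; m*n%n≡0; m*n/n≡m
        ; m<n⇒m/n≡0; +-distrib-/; m≡m%n+[m/n]*n; m%n<n; /-monoˡ-≤)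
open import Data.Nat.ListAction using (sum)
open import Data.Nat.ListAction.Properties using (sum-++; sum-↭)
open import Data.Nat.Tactic.RingSolver using (solve-∀)
open import Data.List.Membership.DecPropositional ℕ._≟_ using (_∈?_)
open import Data.Product using (Σ; _×_; _,_; proj₁; proj₂; swap)
open import Data.Sum using (inj₁; inj₂)
open import Function using (_∘_; mk⇔; Equivalence)
open import Relation.Binary using (tri<; tri≈; tri>)
open import Relation.Binary.PropositionalEquality
open import Relation.Nullary using (¬_; Dec; does; yes; no)
open import Relation.Nullary.Decidable using (dec-true; dec-false; does-⇔)

-- Degree sums and neutrality

sumOfSquares : ℕ → ℕ → ℕ
sumOfSquares x y = x ℕ.* x ℕ.+ y ℕ.* y

module _ {n : ℕ} (G : Graph n) where

  degreeSum : (ℕ → ℕ → ℕ) → ℕ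
  degreeSum g = sum (map (λ e → g (deg G (proj₁ e)) (deg G (proj₂ e))) (edges G))

  size≡degreeSum : size G ≡ degreeSum (λ _ _ → 1)
  size≡degreeSum = length≡sum (edges G)
    where
    length≡sum : ∀ {A : Set} (xs : List A) → length xs ≡ sum (map (λ _ → 1) xs)
    length≡sum []       = refl
    length≡sum (x ∷ xs) = cong suc (length≡sum xs)

-- A separate scope, so that ℚ's _+_ and _*_ are unqualified here and ℕ's after it.
module _ where

  open import Data.Integer as ℤ using (+_)
  import Data.Integer.Properties as ℤ
  open import Data.Rational using (ℚ; _+_; _*_; _-_; ½; 0ℚ; 1ℚ; toℚᵘ)
  import Data.Rational as ℚ
  import Data.Rational.Properties as ℚ
  open import Data.Rational.Unnormalised using (mkℚᵘ; *≡*) renaming (_≃_ to _≃ᵘ_; _+_ to _+ᵘ_; _*_ to _*ᵘ_)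
  import Data.Rational.Unnormalised.Properties as ℚᵘ
  open import Data.Rational.Solver using (module +-*-Solver)

  -- Defs' fromℕ, so that d G u is toℚ (deg G u).
  toℚ : ℕ → ℚ
  toℚ k = + k ℚ./ 1

  private
    toℚᵘ-toℚ : ∀ k → toℚᵘ (toℚ k) ≃ᵘ mkℚᵘ (+ k) 0
    toℚᵘ-toℚ k = ℚ.toℚᵘ-fromℚᵘ (mkℚᵘ (+ k) 0)

  toℚ-+ : ∀ a b → toℚ (a ℕ.+ b) ≡ toℚ a + toℚ b
  toℚ-+ a b = ℚ.toℚᵘ-injective (begin
    toℚᵘ (toℚ (a ℕ.+ b))           ≈⟨ toℚᵘ-toℚ (a ℕ.+ b) ⟩
    mkℚᵘ (+ (a ℕ.+ b)) 0           ≈⟨ *≡* (cong (ℤ._* + 1) +[a+b]≡a*1+b*1) ⟩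
    mkℚᵘ (+ a) 0 +ᵘ mkℚᵘ (+ b) 0   ≈⟨ ℚᵘ.+-cong (toℚᵘ-toℚ a) (toℚᵘ-toℚ b) ⟨
    toℚᵘ (toℚ a) +ᵘ toℚᵘ (toℚ b)   ≈⟨ ℚ.toℚᵘ-homo-+ (toℚ a) (toℚ b) ⟨
    toℚᵘ (toℚ a + toℚ b)           ∎)
    where
    open ℚᵘ.≃-Reasoning
    +[a+b]≡a*1+b*1 : + (a ℕ.+ b) ≡ + a ℤ.* + 1 ℤ.+ + b ℤ.* + 1
    +[a+b]≡a*1+b*1 = trans (ℤ.pos-+ a b) (sym (cong₂ ℤ._+_ (ℤ.*-identityʳ (+ a)) (ℤ.*-identityʳ (+ b))))

  toℚ-* : ∀ a b → toℚ (a ℕ.* b) ≡ toℚ a * toℚ b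
  toℚ-* a b = ℚ.toℚᵘ-injective (begin
    toℚᵘ (toℚ (a ℕ.* b))           ≈⟨ toℚᵘ-toℚ (a ℕ.* b) ⟩
    mkℚᵘ (+ (a ℕ.* b)) 0           ≈⟨ *≡* (cong (ℤ._* + 1) (ℤ.pos-* a b)) ⟩
    mkℚᵘ (+ a) 0 *ᵘ mkℚᵘ (+ b) 0   ≈⟨ ℚᵘ.*-cong (toℚᵘ-toℚ a) (toℚᵘ-toℚ b) ⟨
    toℚᵘ (toℚ a) *ᵘ toℚᵘ (toℚ b)   ≈⟨ ℚ.toℚᵘ-homo-* (toℚ a) (toℚ b) ⟨
    toℚᵘ (toℚ a * toℚ b)           ∎)
    where open ℚᵘ.≃-Reasoning

  toℚ-injective : ∀ {a b} → toℚ a ≡ toℚ b → a ≡ b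
  toℚ-injective {a} {b} eq
    with ℚᵘ.≃-trans (ℚᵘ.≃-sym (toℚᵘ-toℚ a)) (ℚᵘ.≃-trans (ℚᵘ.≃-reflexive (cong toℚᵘ eq)) (toℚᵘ-toℚ b))
  ... | *≡* a*1≡b*1 = ℤ.+-injective (trans (sym (ℤ.*-identityʳ (+ a))) (trans a*1≡b*1 (ℤ.*-identityʳ (+ b))))

  1/m*m≡1 : ∀ m .{{_ : NonZero m}} → (+ 1 ℚ./ m) * toℚ m ≡ 1ℚ
  1/m*m≡1 (suc m) = ℚ.toℚᵘ-injective (begin
    toℚᵘ ((+ 1 ℚ./ suc m) * toℚ (suc m))        ≈⟨ ℚ.toℚᵘ-homo-* (+ 1 ℚ./ suc m) (toℚ (suc m)) ⟩
    toℚᵘ (+ 1 ℚ./ suc m) *ᵘ toℚᵘ (toℚ (suc m))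
      ≈⟨ ℚᵘ.*-cong (ℚ.toℚᵘ-fromℚᵘ (mkℚᵘ (+ 1) m)) (toℚᵘ-toℚ (suc m)) ⟩
    mkℚᵘ (+ 1) m *ᵘ mkℚᵘ (+ suc m) 0
      ≈⟨ *≡* (cong (λ x → + suc x) (trans (cong (ℕ._* 1) (ℕ.+-identityʳ m)) (sym (ℕ.+-identityʳ (m ℕ.* 1))))) ⟩
    toℚᵘ 1ℚ                                     ∎)
    where open ℚᵘ.≃-Reasoning

  module _ {n : ℕ} (G : Graph n) {{_ : NonZero (size G)}} where

    private
      sumE-toℚ : (f : Fin n × Fin n → ℚ) (h : Fin n × Fin n → ℕ) → (∀ e → f e ≡ toℚ (h e)) →
                 ∀ es → sumE G f es ≡ toℚ (sum (map h es))
      sumE-toℚ f h f≡h []       = refl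
      sumE-toℚ f h f≡h (e ∷ es) = trans (cong₂ _+_ (f≡h e) (sumE-toℚ f h f≡h es)) (sym (toℚ-+ (h e) _))

      sumE-½ : ∀ f es → sumE G (λ e → ½ * f e) es ≡ ½ * sumE G f es
      sumE-½ f []       = sym (ℚ.*-zeroʳ ½)
      sumE-½ f (e ∷ es) = trans (cong (λ s → ½ * f e + s) (sumE-½ f es)) (sym (ℚ.*-distribˡ-+ ½ (f e) _))

    minv-cancel : ∀ x → minv G * (x * toℚ (size G)) ≡ x
    minv-cancel x = begin
      μ * (x * M) ≡⟨ solve 3 (λ μ x M → μ :* (x :* M) := x :* (μ :* M)) refl μ x M ⟩
      x * (μ * M) ≡⟨ cong (x *_) (1/m*m≡1 (size G)) ⟩
      x * 1ℚ      ≡⟨ ℚ.*-identityʳ x ⟩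
      x           ∎
      where
      open +-*-Solver
      open ≡-Reasoning
      μ M : ℚ
      μ = minv G
      M = toℚ (size G)

    termA≡ : termA G ≡ minv G * toℚ (degreeSum G ℕ._*_)
    termA≡ = cong (minv G *_) (sumE-toℚ _ (λ (u , v) → deg G u ℕ.* deg G v)
      (λ (u , v) → sym (toℚ-* (deg G u) (deg G v))) (edges G))

    termB≡ : termB G ≡ minv G * (½ * toℚ (degreeSum G ℕ._+_))
    termB≡ = cong (minv G *_) (trans (sumE-½ (λ (u , v) → d G u + d G v) (edges G))
      (cong (½ *_) (sumE-toℚ _ (λ (u , v) → deg G u ℕ.+ deg G v)
        (λ (u , v) → sym (toℚ-+ (deg G u) (deg G v))) (edges G))))

    termC≡ : termC G ≡ minv G * (½ * toℚ (degreeSum G sumOfSquares))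
    termC≡ = cong (minv G *_) (trans (sumE-½ (λ (u , v) → d G u * d G u + d G v * d G v) (edges G))
      (cong (½ *_) (sumE-toℚ _ (λ (u , v) → sumOfSquares (deg G u) (deg G v)) squares (edges G))))
      where
      squares : ∀ ((u , v) : Fin n × Fin n) →
                d G u * d G u + d G v * d G v ≡ toℚ (sumOfSquares (deg G u) (deg G v))
      squares (u , v) = sym (trans (toℚ-+ (deg G u ℕ.* deg G u) _)
                                   (cong₂ _+_ (toℚ-* (deg G u) _) (toℚ-* (deg G v) _)))

  -- α is the mean degree at an end of an edge: the numerator of r is the mean of d_u d_v minus α²,
  -- and its denominator the mean of (d_u² + d_v²)/2 minus α².
  degreeSums⇒neutral : ∀ {n} (G : Graph n) (α : ℕ) → size G ≢ 0 →
                       degreeSum G ℕ._*_ ≡ α ℕ.* α ℕ.* size G →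
                       degreeSum G ℕ._+_ ≡ 2 ℕ.* α ℕ.* size G →
                       degreeSum G sumOfSquares ≢ 2 ℕ.* α ℕ.* α ℕ.* size G →
                       Neutral G
  degreeSums⇒neutral G α m≢0 Σdd≡ααm Σd+d≡2αm Σdd+dd≢2ααm = m≢0′ , denom≢0′ , numer÷denom≡0
    where
    instance
      m≢0′ : NonZero (size G)
      m≢0′ = ℕ.≢-nonZero m≢0
    open +-*-Solver
    open ≡-Reasoning
    M a μ C : ℚ
    M = toℚ (size G)
    a = toℚ α
    μ = minv G
    C = toℚ (degreeSum G sumOfSquares)

    termA≡aa : termA G ≡ a * a
    termA≡aa = begin
      termA G                       ≡⟨ termA≡ G ⟩
      μ * toℚ (degreeSum G ℕ._*_)   ≡⟨ cong (λ s → μ * toℚ s) Σdd≡ααm ⟩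
      μ * toℚ (α ℕ.* α ℕ.* size G)  ≡⟨ cong (μ *_) (trans (toℚ-* (α ℕ.* α) (size G)) (cong (_* M) (toℚ-* α α))) ⟩
      μ * ((a * a) * M)             ≡⟨ minv-cancel G (a * a) ⟩
      a * a                         ∎

    termB≡a : termB G ≡ a
    termB≡a = begin
      termB G                              ≡⟨ termB≡ G ⟩
      μ * (½ * toℚ (degreeSum G ℕ._+_))    ≡⟨ cong (λ s → μ * (½ * toℚ s)) Σd+d≡2αm ⟩
      μ * (½ * toℚ (2 ℕ.* α ℕ.* size G))
        ≡⟨ cong (λ s → μ * (½ * s)) (trans (toℚ-* (2 ℕ.* α) (size G)) (cong (_* M) (toℚ-* 2 α))) ⟩
      μ * (½ * ((toℚ 2 * a) * M))
        ≡⟨ solve 5 (λ μ h t a M → μ :* (h :* ((t :* a) :* M)) := μ :* (((h :* t) :* a) :* M)) refl μ ½ (toℚ 2) a M ⟩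
      μ * ((1ℚ * a) * M)                   ≡⟨ minv-cancel G (1ℚ * a) ⟩
      1ℚ * a                               ≡⟨ ℚ.*-identityˡ a ⟩
      a                                    ∎

    numer≡0 : numer G ≡ 0ℚ
    numer≡0 = begin
      termA G - termB G * termB G ≡⟨ cong₂ (λ x y → x - y * y) termA≡aa termB≡a ⟩
      a * a - a * a               ≡⟨ ℚ.+-inverseʳ (a * a) ⟩
      0ℚ                          ∎

    denom≢0 : denom G ≢ 0ℚ
    denom≢0 denom≡0 = Σdd+dd≢2ααm (toℚ-injective (begin
      C                             ≡⟨ sym (trans (ℚ.*-identityˡ (1ℚ * C)) (ℚ.*-identityˡ C)) ⟩
      1ℚ * (1ℚ * C)                 ≡⟨ cong (λ z → 1ℚ * (z * C)) (sym (1/m*m≡1 (size G))) ⟩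
      (toℚ 2 * ½) * ((μ * M) * C)
        ≡⟨ solve 5 (λ t h μ M C → (t :* h) :* ((μ :* M) :* C) := (t :* M) :* (μ :* (h :* C))) refl (toℚ 2) ½ μ M C ⟩
      (toℚ 2 * M) * (μ * (½ * C))   ≡⟨ cong ((toℚ 2 * M) *_) μ½C≡aa ⟩
      (toℚ 2 * M) * (a * a)         ≡⟨ solve 3 (λ t M a → (t :* M) :* (a :* a) := ((t :* a) :* a) :* M) refl (toℚ 2) M a ⟩
      ((toℚ 2 * a) * a) * M
        ≡⟨ sym (trans (toℚ-* (2 ℕ.* α ℕ.* α) (size G))
                      (cong (_* M) (trans (toℚ-* (2 ℕ.* α) α) (cong (_* a) (toℚ-* 2 α))))) ⟩
      toℚ (2 ℕ.* α ℕ.* α ℕ.* size G) ∎))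
      where
      μ½C≡aa : μ * (½ * C) ≡ a * a
      μ½C≡aa = begin
        μ * (½ * C)                 ≡⟨ termC≡ G ⟨
        termC G                     ≡⟨ solve 2 (λ x y → x := (x :- y) :+ y) refl (termC G) (termB G * termB G) ⟩
        denom G + termB G * termB G ≡⟨ cong₂ (λ x y → x + y * y) denom≡0 termB≡a ⟩
        0ℚ + a * a                  ≡⟨ ℚ.+-identityˡ (a * a) ⟩
        a * a                       ∎

    instance
      denom≢0′ : ℚ.NonZero (denom G)
      denom≢0′ = ℚ.≢-nonZero denom≢0

    numer÷denom≡0 : assortativity G ≡ 0ℚ
    numer÷denom≡0 = trans (cong (_* ℚ.1/ denom G) numer≡0) (ℚ.*-zeroˡ (ℚ.1/ denom G))

open import Data.Nat using (_+_; _*_)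

module _ {n : ℕ} {G : Graph n} where

  walk-++ : ∀ {u v w} → Walk G u v → Walk G v w → Walk G u w
  walk-++ here        q = q
  walk-++ (step uv p) q = step uv (walk-++ p q)

  walk-reverse : ∀ {u v} → Walk G u v → Walk G v u
  walk-reverse here                = here
  walk-reverse (step {u} {w} uw p) = walk-++ (walk-reverse p) (step (subst T (Graph.sym G u w) uw) here)

  rooted⇒connected : (r : Fin n) → (∀ u → Walk G u r) → Connected G
  rooted⇒connected r walk u v = walk-++ (walk u) (walk-reverse (walk v))

  triangle⇒cycle : ∀ {u v w} → u ≢ v → u ≢ w → v ≢ w →
                   T (adj G u v) → T (adj G v w) → T (adj G w u) → Cycle G
  triangle⇒cycle {u} {v} {w} u≢v u≢w v≢w uv vw wu =
    u ∷ v ∷ w ∷ [] , s≤s (s≤s (s≤s z≤n)) ,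
    (u≢v ∷ u≢w ∷ []) ∷ (v≢w ∷ []) ∷ [] ∷ [] ,
    uv , vw , wu , _

sum-applyUpTo-+ : ∀ (f : ℕ → ℕ) m n →
                  sum (applyUpTo f (m + n)) ≡ sum (applyUpTo f m) + sum (applyUpTo (f ∘ (m +_)) n)
sum-applyUpTo-+ f zero    n = refl
sum-applyUpTo-+ f (suc m) n = trans (cong (f 0 +_) (sum-applyUpTo-+ (f ∘ suc) m n)) (sym (ℕ.+-assoc (f 0) _ _))

sum-applyUpTo-cong : ∀ {f g : ℕ → ℕ} n → (∀ {i} → i < n → f i ≡ g i) →
                     sum (applyUpTo f n) ≡ sum (applyUpTo g n)
sum-applyUpTo-cong zero    f≡g = refl
sum-applyUpTo-cong (suc n) f≡g = cong₂ _+_ (f≡g (s≤s z≤n)) (sum-applyUpTo-cong n (f≡g ∘ s≤s))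

sum-applyUpTo-const : ∀ {f : ℕ → ℕ} n {c} → (∀ {i} → i < n → f i ≡ c) → sum (applyUpTo f n) ≡ n * c
sum-applyUpTo-const zero    f≡c = refl
sum-applyUpTo-const (suc n) f≡c = cong₂ _+_ (f≡c (s≤s z≤n)) (sum-applyUpTo-const n (f≡c ∘ s≤s))

sum-applyUpTo-suc : ∀ (f : ℕ → ℕ) n → sum (applyUpTo f (suc n)) ≡ sum (applyUpTo f n) + f n
sum-applyUpTo-suc f n = trans (cong sum (sym (applyUpTo-∷ʳ f n)))
  (trans (sum-++ (applyUpTo f n) _) (cong (sum (applyUpTo f n) +_) (ℕ.+-identityʳ (f n))))

sum-applyUpTo-* : ∀ (f : ℕ → ℕ) L k →
  sum (applyUpTo f (L * k)) ≡ sum (applyUpTo (λ l → sum (applyUpTo (λ t → f (l * k + t)) k)) L)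
sum-applyUpTo-* f zero    k = refl
sum-applyUpTo-* f (suc L) k = begin
  sum (applyUpTo f (k + L * k))
    ≡⟨ sum-applyUpTo-+ f k (L * k) ⟩
  sum (applyUpTo f k) + sum (applyUpTo (f ∘ (k +_)) (L * k))
    ≡⟨ cong (sum (applyUpTo f k) +_) (sum-applyUpTo-* (f ∘ (k +_)) L k) ⟩
  sum (applyUpTo f k) + sum (applyUpTo (λ l → sum (applyUpTo (λ t → f (k + (l * k + t))) k)) L)
    ≡⟨ cong (sum (applyUpTo f k) +_)
         (sum-applyUpTo-cong L (λ _ → sum-applyUpTo-cong k (λ _ → cong f (sym (ℕ.+-assoc k _ _))))) ⟩
  sum (applyUpTo f k) + sum (applyUpTo (λ l → sum (applyUpTo (λ t → f (suc l * k + t)) k)) L) ∎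
  where open ≡-Reasoning

sum-applyUpTo-linear : ∀ (f g : ℕ → ℕ) b c L →
  sum (applyUpTo (λ l → b * f l + c * g l) L) ≡ b * sum (applyUpTo f L) + c * sum (applyUpTo g L)
sum-applyUpTo-linear f g b c zero    = sym (cong₂ _+_ (ℕ.*-zeroʳ b) (ℕ.*-zeroʳ c))
sum-applyUpTo-linear f g b c (suc L) = begin
  b * f 0 + c * g 0 + sum (applyUpTo (λ l → b * f (suc l) + c * g (suc l)) L)
    ≡⟨ cong (b * f 0 + c * g 0 +_) (sum-applyUpTo-linear (f ∘ suc) (g ∘ suc) b c L) ⟩
  b * f 0 + c * g 0 + (b * Σf + c * Σg)
    ≡⟨ interchange (b * f 0) (c * g 0) (b * Σf) (c * Σg) ⟩
  (b * f 0 + b * Σf) + (c * g 0 + c * Σg)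
    ≡⟨ sym (cong₂ _+_ (ℕ.*-distribˡ-+ b (f 0) Σf) (ℕ.*-distribˡ-+ c (g 0) Σg)) ⟩
  b * (f 0 + Σf) + c * (g 0 + Σg) ∎
  where
  open ≡-Reasoning
  Σf Σg : ℕ
  Σf = sum (applyUpTo (f ∘ suc) L)
  Σg = sum (applyUpTo (g ∘ suc) L)
  interchange : ∀ w x y z → w + x + (y + z) ≡ (w + y) + (x + z)
  interchange = solve-∀

sum-applyUpTo-<ᵇ : ∀ (f : Bool → ℕ) b c → sum (applyUpTo (λ t → f (t <ᵇ b)) (b + c)) ≡ b * f true + c * f false
sum-applyUpTo-<ᵇ f b c = trans (sum-applyUpTo-+ _ b c) (cong₂ _+_
  (sum-applyUpTo-const b (λ {t} t<b → cong f (dec-true (t ℕ.<? b) t<b)))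
  (sum-applyUpTo-const c (λ {t} _ → cong f (dec-false (b + t ℕ.<? b) (ℕ.m+n≮m b t)))))

map-toℕ-allFin : ∀ {A : Set} (f : ℕ → A) n → map (f ∘ toℕ) (allFin n) ≡ applyUpTo f n
map-toℕ-allFin f n = trans (map-tabulate (λ i → i) (f ∘ toℕ)) (tabulate-toℕ f n)
  where
  tabulate-toℕ : ∀ {A : Set} (f : ℕ → A) n → tabulate {n = n} (f ∘ toℕ) ≡ applyUpTo f n
  tabulate-toℕ f zero    = refl
  tabulate-toℕ f (suc n) = cong (f 0 ∷_) (tabulate-toℕ (f ∘ suc) n)

sum-filterᵇ-cartesianProduct : ∀ {A B : Set} (p : A × B → Bool) (w : A × B → ℕ) xs ys →
  sum (map w (filterᵇ p (cartesianProduct xs ys))) ≡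
  sum (map (λ x → sum (map (w ∘ (x ,_)) (filterᵇ (p ∘ (x ,_)) ys))) xs)
sum-filterᵇ-cartesianProduct p w []       ys = refl
sum-filterᵇ-cartesianProduct {A} p w (x ∷ xs) ys = begin
  sum (map w (filterᵇ p (map (x ,_) ys ++ cartesianProduct xs ys)))
    ≡⟨ cong (sum ∘ map w) (filter-++ _ (map (x ,_) ys) (cartesianProduct xs ys)) ⟩
  sum (map w (filterᵇ p (map (x ,_) ys) ++ filterᵇ p (cartesianProduct xs ys)))
    ≡⟨ trans (cong sum (map-++ w (filterᵇ p (map (x ,_) ys)) _)) (sum-++ (map w (filterᵇ p (map (x ,_) ys))) _) ⟩
  sum (map w (filterᵇ p (map (x ,_) ys))) + sum (map w (filterᵇ p (cartesianProduct xs ys)))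
    ≡⟨ cong₂ _+_ first-row (sum-filterᵇ-cartesianProduct p w xs ys) ⟩
  row x + sum (map row xs) ∎
  where
  open ≡-Reasoning
  row : A → ℕ
  row x = sum (map (w ∘ (x ,_)) (filterᵇ (p ∘ (x ,_)) ys))
  filterᵇ-map : ∀ ys → filterᵇ p (map (x ,_) ys) ≡ map (x ,_) (filterᵇ (p ∘ (x ,_)) ys)
  filterᵇ-map []       = refl
  filterᵇ-map (y ∷ ys) with p (x , y)
  ... | true  = cong ((x , y) ∷_) (filterᵇ-map ys)
  ... | false = filterᵇ-map ys
  first-row : sum (map w (filterᵇ p (map (x ,_) ys))) ≡ row x
  first-row = trans (cong (sum ∘ map w) (filterᵇ-map ys)) (cong sum (sym (map-∘ (filterᵇ (p ∘ (x ,_)) ys))))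

-- Graphs given by neighbour lists

T-does⁺ : ∀ {A : Set} (a? : Dec A) → A → T (does a?)
T-does⁺ (yes _) _ = _
T-does⁺ (no ¬a) a = ¬a a

T-does⁻ : ∀ {A : Set} (a? : Dec A) → T (does a?) → A
T-does⁻ (yes a) _ = a

-- The vertices are 0 … n - 1: by nbrs-< and nbrs-sym, no x ≥ n has a neighbour.
record NeighbourLists (n : ℕ) : Set where
  field
    nbrs        : ℕ → List ℕ
    nbrs-<      : ∀ {x y} → y ∈ nbrs x → y < n
    nbrs-sym    : ∀ {x y} → y ∈ nbrs x → x ∈ nbrs y
    nbrs-irrefl : ∀ x → x ∉ nbrs x
    nbrs-unique : ∀ x → Unique (nbrs x)

  degree : ℕ → ℕ
  degree x = length (nbrs x)

  localSum : (ℕ → ℕ → ℕ) → ℕ → ℕ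
  localSum g x = sum (map (λ y → g (degree x) (degree y)) (nbrs x))

module _ {n : ℕ} (L : NeighbourLists n) where
  open NeighbourLists L

  toGraph : Graph n
  toGraph = record
    { adj    = λ i j → does (toℕ j ∈? nbrs (toℕ i))
    ; sym    = λ i j → does-⇔ (mk⇔ nbrs-sym nbrs-sym) (toℕ j ∈? _) (toℕ i ∈? _)
    ; irrefl = λ i → dec-false (toℕ i ∈? _) (nbrs-irrefl (toℕ i))
    }

  private
    G : Graph n
    G = toGraph

  adj-toGraph : ∀ {x y} (x<n : x < n) (y<n : y < n) → y ∈ nbrs x → T (adj G (fromℕ< x<n) (fromℕ< y<n))
  adj-toGraph {x} {y} x<n y<n y∈ = T-does⁺ (toℕ (fromℕ< y<n) ∈? nbrs (toℕ (fromℕ< x<n)))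
    (subst₂ (λ a b → a ∈ nbrs b) (sym (toℕ-fromℕ< y<n)) (sym (toℕ-fromℕ< x<n)) y∈)

  row-↭ : ∀ i → map toℕ (filterᵇ (adj G i) (allFin n)) ↭ nbrs (toℕ i)
  row-↭ i = ∼bag⇒↭ (unique∧set⇒bag
    (Unique.map⁺ toℕ-injective (Unique.filter⁺ (T? ∘ adj G i) (Unique.allFin⁺ n)))
    (nbrs-unique (toℕ i))
    (mk⇔ to from))
    where
    to : ∀ {y} → y ∈ map toℕ (filterᵇ (adj G i) (allFin n)) → y ∈ nbrs (toℕ i)
    to y∈ with j , j∈ , refl ← ∈-map⁻ toℕ y∈ =
      T-does⁻ (toℕ j ∈? nbrs (toℕ i)) (proj₂ (∈-filter⁻ (T? ∘ adj G i) {xs = allFin n} j∈))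
    from : ∀ {y} → y ∈ nbrs (toℕ i) → y ∈ map toℕ (filterᵇ (adj G i) (allFin n))
    from {y} y∈ = subst (_∈ _) (toℕ-fromℕ< y<n) (∈-map⁺ toℕ (∈-filter⁺ (T? ∘ adj G i) {xs = allFin n} (∈-allFin j)
      (T-does⁺ (toℕ j ∈? _) (subst (_∈ _) (sym (toℕ-fromℕ< y<n)) y∈))))
      where
      y<n : y < n
      y<n = nbrs-< y∈
      j : Fin n
      j = fromℕ< y<n

  deg-toGraph : ∀ i → deg G i ≡ degree (toℕ i)
  deg-toGraph i = trans (sym (length-map toℕ (filterᵇ (adj G i) (allFin n)))) (↭-length (row-↭ i))

  private
    A : List (Fin n)
    A = allFin n
    E : List (Fin n × Fin n)
    E = edges G
    adjacent : Fin n × Fin n → Bool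
    adjacent (i , j) = adj G i j

    ∈-pairs⁻ : ∀ (p : Fin n × Fin n → Bool) {e} → e ∈ filterᵇ p (cartesianProduct A A) → T (p e)
    ∈-pairs⁻ p e∈ = proj₂ (∈-filter⁻ (T? ∘ p) {xs = cartesianProduct A A} e∈)

    ∈-pairs⁺ : ∀ (p : Fin n × Fin n → Bool) {e} → T (p e) → e ∈ filterᵇ p (cartesianProduct A A)
    ∈-pairs⁺ p {i , j} = ∈-filter⁺ (T? ∘ p) (∈-cartesianProduct⁺ (∈-allFin i) (∈-allFin j))

    unique-pairs : ∀ (p : Fin n × Fin n → Bool) → Unique (filterᵇ p (cartesianProduct A A))
    unique-pairs p = Unique.filter⁺ (T? ∘ p) (Unique.cartesianProduct⁺ (Unique.allFin⁺ n) (Unique.allFin⁺ n))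

    ordered : ∀ {i j} → (i , j) ∈ E → toℕ i < toℕ j
    ordered e∈ = ℕ.<ᵇ⇒< _ _ (proj₂ (Equivalence.to T-∧ (∈-pairs⁻ _ e∈)))

  edges-↭ : E ++ map swap E ↭ filterᵇ adjacent (cartesianProduct A A)
  edges-↭ = ∼bag⇒↭ (unique∧set⇒bag
    (Unique.++⁺ (unique-pairs _) (Unique.map⁺ (cong swap) (unique-pairs _)) disjoint)
    (unique-pairs adjacent)
    (mk⇔ to from))
    where
    disjoint : ∀ {e} → ¬ (e ∈ E × e ∈ map swap E)
    disjoint (e∈ , e∈swapE) with _ , e′∈ , refl ← ∈-map⁻ swap e∈swapE = ℕ.<-asym (ordered e∈) (ordered e′∈)
    to : ∀ {e} → e ∈ E ++ map swap E → e ∈ filterᵇ adjacent (cartesianProduct A A)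
    to e∈ with ∈-++⁻ E e∈
    ... | inj₁ e∈E = ∈-pairs⁺ adjacent (proj₁ (Equivalence.to T-∧ (∈-pairs⁻ _ e∈E)))
    ... | inj₂ e∈swapE with (j , i) , e′∈ , refl ← ∈-map⁻ swap e∈swapE =
      ∈-pairs⁺ adjacent (subst T (Graph.sym G j i) (proj₁ (Equivalence.to T-∧ (∈-pairs⁻ _ e′∈))))
    from : ∀ {e} → e ∈ filterᵇ adjacent (cartesianProduct A A) → e ∈ E ++ map swap E
    from {i , j} e∈ with ℕ.<-cmp (toℕ i) (toℕ j)
    ... | tri< i<j _ _ = ∈-++⁺ˡ (∈-pairs⁺ _ (Equivalence.from T-∧ (∈-pairs⁻ adjacent e∈ , ℕ.<⇒<ᵇ i<j)))
    ... | tri≈ _ i≡j _ =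
      ⊥-elim (subst T (trans (cong (adj G i) (sym (toℕ-injective i≡j))) (Graph.irrefl G i)) (∈-pairs⁻ adjacent e∈))
    ... | tri> _ _ j<i = ∈-++⁺ʳ E (∈-map⁺ swap (∈-pairs⁺ _
      (Equivalence.from T-∧ (subst T (Graph.sym G i j) (∈-pairs⁻ adjacent e∈) , ℕ.<⇒<ᵇ j<i))))

  degreeSum-toGraph : ∀ g → (∀ x y → g x y ≡ g y x) → 2 * degreeSum G g ≡ sum (applyUpTo (localSum g) n)
  degreeSum-toGraph g g-sym = begin
    2 * degreeSum G g
      ≡⟨ cong (λ s → s + (s + 0)) (cong sum (map-cong (λ (i , j) → cong₂ g (deg-toGraph i) (deg-toGraph j)) E)) ⟩
    sum (map W E) + (sum (map W E) + 0)
      ≡⟨ cong (sum (map W E) +_) (trans (ℕ.+-identityʳ _) (cong sum (trans (map-cong (λ (i , j) → g-sym _ _) E) (map-∘ E)))) ⟩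
    sum (map W E) + sum (map W (map swap E))
      ≡⟨ sym (trans (cong sum (map-++ W E (map swap E))) (sum-++ (map W E) _)) ⟩
    sum (map W (E ++ map swap E))
      ≡⟨ sum-↭ (↭-map⁺ W edges-↭) ⟩
    sum (map W (filterᵇ adjacent (cartesianProduct A A)))
      ≡⟨ sum-filterᵇ-cartesianProduct adjacent W A A ⟩
    sum (map (λ i → sum (map (W ∘ (i ,_)) (filterᵇ (adj G i) A))) A)
      ≡⟨ cong sum (map-cong row A) ⟩
    sum (map (localSum g ∘ toℕ) A)
      ≡⟨ cong sum (map-toℕ-allFin (localSum g) n) ⟩
    sum (applyUpTo (localSum g) n) ∎
    where
    open ≡-Reasoning
    W : Fin n × Fin n → ℕ
    W (i , j) = g (degree (toℕ i)) (degree (toℕ j))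
    row : ∀ i → sum (map (W ∘ (i ,_)) (filterᵇ (adj G i) A)) ≡ localSum g (toℕ i)
    row i = trans (cong sum (map-∘ (filterᵇ (adj G i) A))) (sum-↭ (↭-map⁺ _ (row-↭ i)))

  data Path : ℕ → ℕ → Set where
    []  : ∀ {x} → Path x x
    _∷_ : ∀ {x y z} → y ∈ nbrs x → Path y z → Path x z

  toWalk : ∀ {x y} (x<n : x < n) (y<n : y < n) → Path x y → Walk G (fromℕ< x<n) (fromℕ< y<n)
  toWalk x<n y<n []       = here
  toWalk x<n y<n (y∈ ∷ p) = step (adj-toGraph x<n (nbrs-< y∈) y∈) (toWalk (nbrs-< y∈) y<n p)

  connected-toGraph : ∀ {r} → r < n → (∀ {x} → x < n → Path x r) → Connected G
  connected-toGraph r<n path = rooted⇒connected (fromℕ< r<n) λ u →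
    subst (λ u → Walk G u (fromℕ< r<n)) (fromℕ<-toℕ u (toℕ<n u)) (toWalk (toℕ<n u) r<n (path (toℕ<n u)))

  triangle-toGraph : ∀ {x y z} → x ≢ y → x ≢ z → y ≢ z →
                     y ∈ nbrs x → z ∈ nbrs y → x ∈ nbrs z → Cycle G
  triangle-toGraph {x} {y} {z} x≢y x≢z y≢z y∈ z∈ x∈ = triangle⇒cycle
    (x≢y ∘ fromℕ<-injective x y x<n y<n) (x≢z ∘ fromℕ<-injective x z x<n z<n) (y≢z ∘ fromℕ<-injective y z y<n z<n)
    (adj-toGraph x<n y<n y∈) (adj-toGraph y<n z<n z∈) (adj-toGraph z<n x<n x∈)
    where
    x<n : x < n
    x<n = nbrs-< x∈
    y<n : y < n
    y<n = nbrs-< y∈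
    z<n : z < n
    z<n = nbrs-< z∈

module Necklace (k b : ℕ) (2≤k : 2 ≤ k) (b≤k : b ≤ k) where

  instance
    k≢0 : NonZero k
    k≢0 = ℕ.>-nonZero (ℕ.<-≤-trans (s≤s z≤n) 2≤k)

  c : ℕ
  c = k ∸ b

  N : ℕ
  N = 5 * k + b

  next prev : Fin k → Fin k
  next i = suc (toℕ i) mod k
  prev i = (toℕ i + pred k) mod k

  private
    [m+n%k]%k≡[m+n]%k : ∀ m n → (m + n % k) % k ≡ (m + n) % k
    [m+n%k]%k≡[m+n]%k m n = begin
      (m + n % k) % k           ≡⟨ %-distribˡ-+ m (n % k) k ⟩
      (m % k + n % k % k) % k   ≡⟨ cong (λ r → (m % k + r) % k) (m%n%n≡m%n n k) ⟩
      (m % k + n % k) % k       ≡⟨ %-distribˡ-+ m n k ⟨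
      (m + n) % k               ∎
      where open ≡-Reasoning

    [1+t+k-1]%k≡t : ∀ {t} → t < k → suc (t + pred k) % k ≡ t
    [1+t+k-1]%k≡t {t} t<k = begin
      suc (t + pred k) % k  ≡⟨ cong (_% k) (trans (sym (ℕ.+-suc t (pred k))) (cong (t +_) (ℕ.suc-pred k))) ⟩
      (t + k) % k           ≡⟨ [m+n]%n≡m%n t k ⟩
      t % k                 ≡⟨ m<n⇒m%n≡m t<k ⟩
      t                     ∎
      where open ≡-Reasoning

  next-prev : ∀ i → next (prev i) ≡ i
  next-prev i = toℕ-injective (begin
    toℕ (next (prev i))               ≡⟨ toℕ-fromℕ< _ ⟩
    suc (toℕ (prev i)) % k            ≡⟨ cong (λ r → suc r % k) (toℕ-fromℕ< _) ⟩
    (1 + (toℕ i + pred k) % k) % k    ≡⟨ [m+n%k]%k≡[m+n]%k 1 (toℕ i + pred k) ⟩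
    suc (toℕ i + pred k) % k          ≡⟨ [1+t+k-1]%k≡t (toℕ<n i) ⟩
    toℕ i                             ∎)
    where open ≡-Reasoning

  prev-next : ∀ i → prev (next i) ≡ i
  prev-next i = toℕ-injective (begin
    toℕ (prev (next i))               ≡⟨ toℕ-fromℕ< _ ⟩
    (toℕ (next i) + pred k) % k       ≡⟨ cong (λ r → (r + pred k) % k) (toℕ-fromℕ< _) ⟩
    (suc (toℕ i) % k + pred k) % k    ≡⟨ cong (_% k) (ℕ.+-comm _ (pred k)) ⟩
    (pred k + suc (toℕ i) % k) % k    ≡⟨ [m+n%k]%k≡[m+n]%k (pred k) (suc (toℕ i)) ⟩
    (pred k + suc (toℕ i)) % k        ≡⟨ cong (_% k) (ℕ.+-comm (pred k) (suc (toℕ i))) ⟩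
    suc (toℕ i + pred k) % k          ≡⟨ [1+t+k-1]%k≡t (toℕ<n i) ⟩
    toℕ i                             ∎)
    where open ≡-Reasoning

  next-≢ : ∀ i → next i ≢ i
  next-≢ i next≡i with ℕ.m≤n⇒m<n∨m≡n (toℕ<n i)
  ... | inj₁ 1+i<k = ℕ.1+n≢n (trans (sym (m<n⇒m%n≡m 1+i<k)) (trans (sym (toℕ-fromℕ< _)) (cong toℕ next≡i)))
  ... | inj₂ 1+i≡k = ℕ.<⇒≱ 2≤k (ℕ.≤-reflexive (trans (sym 1+i≡k) (cong suc i≡0)))
    where
    i≡0 : toℕ i ≡ 0
    i≡0 = trans (sym (cong toℕ next≡i)) (trans (toℕ-fromℕ< _) (trans (cong (_% k) 1+i≡k) (n%n≡0 k)))

  toℕ-prev : ∀ {i t} → toℕ i ≡ suc t → toℕ (prev i) ≡ t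
  toℕ-prev {i} {t} i≡1+t = trans (toℕ-fromℕ< _) (trans (cong (λ s → (s + pred k) % k) i≡1+t)
    ([1+t+k-1]%k≡t (ℕ.<-trans (ℕ.n<1+n t) (subst (_< k) i≡1+t (toℕ<n i)))))

  prev-≢ : ∀ i → prev i ≢ i
  prev-≢ i prev≡i = next-≢ i (trans (cong next (sym prev≡i)) (next-prev i))

  -- (l , i) is the vertex aₗ of bead i, numbered l * k + i.
  Position : Set
  Position = ℕ × Fin k

  code : Position → ℕ
  code (l , i) = l * k + toℕ i

  decode : ℕ → Position
  decode x = x / k , x mod k

  decode-code : ∀ p → decode (code p) ≡ p
  decode-code (l , i) = cong₂ _,_ quotient (toℕ-injective remainder)
    where
    i%k≡i : toℕ i % k ≡ toℕ i
    i%k≡i = m<n⇒m%n≡m (toℕ<n i)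
    quotient : (l * k + toℕ i) / k ≡ l
    quotient = begin
      (l * k + toℕ i) / k
        ≡⟨ +-distrib-/ (l * k) (toℕ i) (subst₂ (λ a b → a + b < k) (sym (m*n%n≡0 l k)) (sym i%k≡i) (toℕ<n i)) ⟩
      l * k / k + toℕ i / k   ≡⟨ cong₂ _+_ (m*n/n≡m l k) (m<n⇒m/n≡0 (toℕ<n i)) ⟩
      l + 0                   ≡⟨ ℕ.+-identityʳ l ⟩
      l                       ∎
      where open ≡-Reasoning
    remainder : toℕ ((l * k + toℕ i) mod k) ≡ toℕ i
    remainder = begin
      toℕ ((l * k + toℕ i) mod k)  ≡⟨ toℕ-fromℕ< _ ⟩
      (l * k + toℕ i) % k          ≡⟨ cong (_% k) (ℕ.+-comm (l * k) (toℕ i)) ⟩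
      (toℕ i + l * k) % k          ≡⟨ [m+kn]%n≡m%n (toℕ i) l k ⟩
      toℕ i % k                    ≡⟨ i%k≡i ⟩
      toℕ i                        ∎
      where open ≡-Reasoning

  code-decode : ∀ x → code (decode x) ≡ x
  code-decode x = begin
    x / k * k + toℕ (x mod k)  ≡⟨ cong (x / k * k +_) (toℕ-fromℕ< _) ⟩
    x / k * k + x % k          ≡⟨ ℕ.+-comm (x / k * k) (x % k) ⟩
    x % k + x / k * k          ≡⟨ m≡m%n+[m/n]*n x k ⟨
    x                          ∎
    where open ≡-Reasoning

  code-injective : ∀ {p q} → code p ≡ code q → p ≡ q
  code-injective {p} {q} eq = trans (sym (decode-code p)) (trans (cong decode eq) (decode-code q))

  hasPendant : Fin k → Bool
  hasPendant i = toℕ i <ᵇ b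

  listIf : {A : Set} → Bool → A → List A
  listIf true  x = x ∷ []
  listIf false _ = []

  ∈-listIf⁺ : ∀ {A : Set} {h} {x : A} → T h → x ∈ listIf h x
  ∈-listIf⁺ {h = true} _ = here refl

  ∈-listIf⁻ : ∀ {A : Set} {h} {x y : A} → y ∈ listIf h x → T h × y ≡ x
  ∈-listIf⁻ {h = true} (here refl) = _ , refl

  All-listIf : ∀ {A : Set} {P : A → Set} {h} {x : A} → (T h → P x) → All P (listIf h x)
  All-listIf {h = true}  px = px _ ∷ []
  All-listIf {h = false} px = []

  nbrsAt : Position → List Position
  nbrsAt (0 , i) = (1 , i) ∷ (3 , i) ∷ (4 , i) ∷ (4 , prev i) ∷ []
  nbrsAt (1 , i) = (0 , i) ∷ (2 , i) ∷ (4 , i) ∷ []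
  nbrsAt (2 , i) = (1 , i) ∷ (3 , i) ∷ []
  nbrsAt (3 , i) = (0 , i) ∷ (2 , i) ∷ listIf (hasPendant i) (5 , i)
  nbrsAt (4 , i) = (0 , i) ∷ (1 , i) ∷ (0 , next i) ∷ []
  nbrsAt (5 , i) = listIf (hasPendant i) (3 , i)
  nbrsAt _       = []

  nbrsAt-sym : ∀ {p q} → q ∈ nbrsAt p → p ∈ nbrsAt q
  nbrsAt-sym {0 , i} (here refl)                         = here refl
  nbrsAt-sym {0 , i} (there (here refl))                 = here refl
  nbrsAt-sym {0 , i} (there (there (here refl)))         = here refl
  nbrsAt-sym {0 , i} (there (there (there (here refl)))) = there (there (here (cong (0 ,_) (sym (next-prev i)))))
  nbrsAt-sym {1 , i} (here refl)                         = here refl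
  nbrsAt-sym {1 , i} (there (here refl))                 = here refl
  nbrsAt-sym {1 , i} (there (there (here refl)))         = there (here refl)
  nbrsAt-sym {2 , i} (here refl)                         = there (here refl)
  nbrsAt-sym {2 , i} (there (here refl))                 = there (here refl)
  nbrsAt-sym {3 , i} (here refl)                         = there (here refl)
  nbrsAt-sym {3 , i} (there (here refl))                 = there (here refl)
  nbrsAt-sym {3 , i} (there (there q∈)) with pendant , refl ← ∈-listIf⁻ q∈ = ∈-listIf⁺ pendant
  nbrsAt-sym {4 , i} (here refl)                         = there (there (here refl))
  nbrsAt-sym {4 , i} (there (here refl))                 = there (there (here refl))
  nbrsAt-sym {4 , i} (there (there (here refl)))         = there (there (there (here (cong (4 ,_) (sym (prev-next i))))))
  nbrsAt-sym {5 , i} q∈ with pendant , refl ← ∈-listIf⁻ q∈ = there (there (∈-listIf⁺ pendant))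

  nbrsAt-otherLayer : ∀ l i → All (λ q → proj₁ q ≢ l) (nbrsAt (l , i))
  nbrsAt-otherLayer 0 i = (λ ()) ∷ (λ ()) ∷ (λ ()) ∷ (λ ()) ∷ []
  nbrsAt-otherLayer 1 i = (λ ()) ∷ (λ ()) ∷ (λ ()) ∷ []
  nbrsAt-otherLayer 2 i = (λ ()) ∷ (λ ()) ∷ []
  nbrsAt-otherLayer 3 i = (λ ()) ∷ (λ ()) ∷ All-listIf (λ _ ())
  nbrsAt-otherLayer 4 i = (λ ()) ∷ (λ ()) ∷ (λ ()) ∷ []
  nbrsAt-otherLayer 5 i = All-listIf (λ _ ())
  nbrsAt-otherLayer (suc (suc (suc (suc (suc (suc l)))))) i = []

  nbrsAt-irrefl : ∀ p → p ∉ nbrsAt p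
  nbrsAt-irrefl (l , i) p∈ = All.lookup (nbrsAt-otherLayer l i) p∈ refl

  nbrsAt-unique : ∀ p → Unique (nbrsAt p)
  nbrsAt-unique (0 , i) =
    ((λ ()) ∷ (λ ()) ∷ (λ ()) ∷ []) ∷ ((λ ()) ∷ (λ ()) ∷ []) ∷ ((prev-≢ i ∘ sym ∘ cong proj₂) ∷ []) ∷ [] ∷ []
  nbrsAt-unique (1 , i) = ((λ ()) ∷ (λ ()) ∷ []) ∷ ((λ ()) ∷ []) ∷ [] ∷ []
  nbrsAt-unique (2 , i) = ((λ ()) ∷ []) ∷ [] ∷ []
  nbrsAt-unique (3 , i) = ((λ ()) ∷ All-listIf (λ _ ())) ∷ All-listIf (λ _ ()) ∷ unique-listIf (hasPendant i)
    where
    unique-listIf : ∀ h → Unique (listIf {A = Position} h (5 , i))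
    unique-listIf true  = [] ∷ []
    unique-listIf false = []
  nbrsAt-unique (4 , i) = ((λ ()) ∷ (next-≢ i ∘ sym ∘ cong proj₂) ∷ []) ∷ ((λ ()) ∷ []) ∷ [] ∷ []
  nbrsAt-unique (5 , i) with hasPendant i
  ... | true  = [] ∷ []
  ... | false = []
  nbrsAt-unique (suc (suc (suc (suc (suc (suc l))))) , i) = []

  Valid : Position → Set
  Valid (l , i) = T ((l <ᵇ 5) ∨ ((l ≡ᵇ 5) ∧ hasPendant i))

  nbrsAt-valid : ∀ p → All Valid (nbrsAt p)
  nbrsAt-valid (0 , i) = _ ∷ _ ∷ _ ∷ _ ∷ []
  nbrsAt-valid (1 , i) = _ ∷ _ ∷ _ ∷ []
  nbrsAt-valid (2 , i) = _ ∷ _ ∷ []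
  nbrsAt-valid (3 , i) = _ ∷ _ ∷ All-listIf (λ pendant → pendant)
  nbrsAt-valid (4 , i) = _ ∷ _ ∷ _ ∷ []
  nbrsAt-valid (5 , i) = All-listIf _
  nbrsAt-valid (suc (suc (suc (suc (suc (suc l))))) , i) = []

  code-< : ∀ {p} → Valid p → code p < N
  code-< {l , i} valid with Equivalence.to T-∨ valid
  ... | inj₁ l<5 = begin-strict
    l * k + toℕ i  <⟨ ℕ.+-monoʳ-< (l * k) (toℕ<n i) ⟩
    l * k + k      ≡⟨ ℕ.+-comm (l * k) k ⟩
    suc l * k      ≤⟨ ℕ.*-monoˡ-≤ k (ℕ.<ᵇ⇒< l 5 l<5) ⟩
    5 * k          ≤⟨ ℕ.m≤m+n (5 * k) b ⟩
    N              ∎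
    where open ℕ.≤-Reasoning
  ... | inj₂ l≡5∧pendant with Equivalence.to T-∧ l≡5∧pendant
  ...   | l≡5 , pendant rewrite ℕ.≡ᵇ⇒≡ l 5 l≡5 = ℕ.+-monoʳ-< (5 * k) (ℕ.<ᵇ⇒< (toℕ i) b pendant)

  <N⇒valid : ∀ {x} → x < N → Valid (decode x)
  <N⇒valid {x} x<N = valid (decode x) (subst (_< N) (sym (code-decode x)) x<N)
    where
    valid : ∀ p → code p < N → Valid p
    valid (0 , i) _ = _
    valid (1 , i) _ = _
    valid (2 , i) _ = _
    valid (3 , i) _ = _
    valid (4 , i) _ = _
    valid (5 , i) code<N = ℕ.<⇒<ᵇ (ℕ.+-cancelˡ-< (5 * k) (toℕ i) b code<N)
    valid (suc (suc (suc (suc (suc (suc l))))) , i) code<N = ⊥-elim (ℕ.<⇒≱ code<N (begin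
      5 * k + b           ≤⟨ ℕ.+-monoʳ-≤ (5 * k) b≤k ⟩
      5 * k + k           ≡⟨ ℕ.+-comm (5 * k) k ⟩
      6 * k               ≤⟨ ℕ.*-monoˡ-≤ k (ℕ.m≤m+n 6 l) ⟩
      (6 + l) * k         ≤⟨ ℕ.m≤m+n _ (toℕ i) ⟩
      (6 + l) * k + toℕ i ∎))
      where open ℕ.≤-Reasoning

  necklace : NeighbourLists N
  necklace = record
    { nbrs        = nbrs
    ; nbrs-<      = bounded
    ; nbrs-sym    = symmetric
    ; nbrs-irrefl = irreflexive
    ; nbrs-unique = λ x → Unique.map⁺ code-injective (nbrsAt-unique (decode x))
    }
    where
    nbrs : ℕ → List ℕ
    nbrs x = map code (nbrsAt (decode x))
    bounded : ∀ {x y} → y ∈ nbrs x → y < N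
    bounded {x} y∈ with q , q∈ , refl ← ∈-map⁻ code y∈ = code-< {q} (All.lookup (nbrsAt-valid (decode x)) q∈)
    symmetric : ∀ {x y} → y ∈ nbrs x → x ∈ nbrs y
    symmetric {x} y∈ with q , q∈ , refl ← ∈-map⁻ code y∈ =
      subst (λ z → z ∈ nbrs (code q)) (code-decode x)
        (subst (λ p → code (decode x) ∈ map code (nbrsAt p)) (sym (decode-code q)) (∈-map⁺ code (nbrsAt-sym {decode x} q∈)))
    irreflexive : ∀ x → x ∉ nbrs x
    irreflexive x x∈ with q , q∈ , x≡ ← ∈-map⁻ code x∈ =
      nbrsAt-irrefl q (subst (λ p → q ∈ nbrsAt p) (trans (cong decode x≡) (decode-code q)) q∈)

  open NeighbourLists necklace

  nbrs-code : ∀ p → nbrs (code p) ≡ map code (nbrsAt p)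
  nbrs-code p = cong (map code ∘ nbrsAt) (decode-code p)

  G : Graph N
  G = toGraph necklace

  pairSum : (ℕ → ℕ → ℕ) → Position → ℕ
  pairSum g p = sum (map (λ q → g (length (nbrsAt p)) (length (nbrsAt q))) (nbrsAt p))

  degree-code : ∀ p → degree (code p) ≡ length (nbrsAt p)
  degree-code p = trans (cong length (nbrs-code p)) (length-map code (nbrsAt p))

  localSum-code : ∀ g p → localSum g (code p) ≡ pairSum g p
  localSum-code g p = begin
    sum (map (λ y → g (degree (code p)) (degree y)) (nbrs (code p)))
      ≡⟨ cong (sum ∘ map (λ y → g (degree (code p)) (degree y))) (nbrs-code p) ⟩
    sum (map (λ y → g (degree (code p)) (degree y)) (map code (nbrsAt p)))
      ≡⟨ cong sum (sym (map-∘ (nbrsAt p))) ⟩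
    sum (map (λ q → g (degree (code p)) (degree (code q))) (nbrsAt p))
      ≡⟨ cong sum (map-cong (λ q → cong₂ g (degree-code p) (degree-code q)) (nbrsAt p)) ⟩
    pairSum g p ∎
    where open ≡-Reasoning

  -- layerSum g l h adds up g d_u d_v over the edges at aₗ, in a bead with (h = true) or without a
  -- pendant; d₃ h is the degree of its a₃.
  d₃ : Bool → ℕ
  d₃ true  = 3
  d₃ false = 2

  layerSum : (ℕ → ℕ → ℕ) → ℕ → Bool → ℕ
  layerSum g 0 h = sum (g 4 3 ∷ g 4 (d₃ h) ∷ g 4 3 ∷ g 4 3 ∷ [])
  layerSum g 1 h = sum (g 3 4 ∷ g 3 2 ∷ g 3 3 ∷ [])
  layerSum g 2 h = sum (g 2 3 ∷ g 2 (d₃ h) ∷ [])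
  layerSum g 3 h = sum (g (d₃ h) 4 ∷ g (d₃ h) 2 ∷ listIf h (g 3 1))
  layerSum g 4 h = sum (g 3 4 ∷ g 3 3 ∷ g 3 4 ∷ [])
  layerSum g 5 h = sum (listIf h (g 1 3))
  layerSum g _ h = 0

  pairSum-layer : ∀ g l i → pairSum g (l , i) ≡ layerSum g l (hasPendant i)
  pairSum-layer g 0 i with hasPendant i
  ... | true  = refl
  ... | false = refl
  pairSum-layer g 1 i = refl
  pairSum-layer g 2 i with hasPendant i
  ... | true  = refl
  ... | false = refl
  -- In layers 3 and 5, hasPendant i also occurs under a map, where with does not abstract it.
  pairSum-layer g 3 i with hasPendant i in pendant
  ... | true  rewrite pendant = refl
  ... | false = refl
  pairSum-layer g 4 i = refl
  pairSum-layer g 5 i with hasPendant i in pendant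
  ... | true  rewrite pendant = refl
  ... | false = refl
  pairSum-layer g (suc (suc (suc (suc (suc (suc l)))))) i = refl

  localSum-layer : ∀ g l {t} → t < k → localSum g (l * k + t) ≡ layerSum g l (t <ᵇ b)
  localSum-layer g l {t} t<k = begin
    localSum g (l * k + t)       ≡⟨ cong (λ s → localSum g (l * k + s)) (toℕ-fromℕ< t<k) ⟨
    localSum g (code (l , i))    ≡⟨ localSum-code g (l , i) ⟩
    pairSum g (l , i)            ≡⟨ pairSum-layer g l i ⟩
    layerSum g l (hasPendant i)  ≡⟨ cong (λ s → layerSum g l (s <ᵇ b)) (toℕ-fromℕ< t<k) ⟩
    layerSum g l (t <ᵇ b)        ∎
    where
    open ≡-Reasoning
    i : Fin k
    i = fromℕ< t<k

  beadSum : (ℕ → ℕ → ℕ) → Bool → ℕ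
  beadSum g h = sum (applyUpTo (λ l → layerSum g l h) 6)

  localSum-total : ∀ g → sum (applyUpTo (localSum g) N) ≡ b * beadSum g true + c * beadSum g false
  localSum-total g = begin
    sum (applyUpTo F (5 * k + b))
      ≡⟨ sum-applyUpTo-+ F (5 * k) b ⟩
    sum (applyUpTo F (5 * k)) + sum (applyUpTo (λ t → F (5 * k + t)) b)
      ≡⟨ cong₂ _+_ beads pendants ⟩
    sum (applyUpTo (λ l → b * L l true + c * L l false) 5) + (b * L 5 true + c * L 5 false)
      ≡⟨ sum-applyUpTo-suc (λ l → b * L l true + c * L l false) 5 ⟨
    sum (applyUpTo (λ l → b * L l true + c * L l false) 6)
      ≡⟨ sum-applyUpTo-linear (λ l → L l true) (λ l → L l false) b c 6 ⟩
    b * beadSum g true + c * beadSum g false ∎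
    where
    open ≡-Reasoning
    F : ℕ → ℕ
    F = localSum g
    L : ℕ → Bool → ℕ
    L = layerSum g
    beads : sum (applyUpTo F (5 * k)) ≡ sum (applyUpTo (λ l → b * L l true + c * L l false) 5)
    beads = trans (sum-applyUpTo-* F 5 k) (sum-applyUpTo-cong 5 (λ {l} _ → begin
      sum (applyUpTo (λ t → F (l * k + t)) k)       ≡⟨ sum-applyUpTo-cong k (localSum-layer g l) ⟩
      sum (applyUpTo (λ t → L l (t <ᵇ b)) k)        ≡⟨ cong (sum ∘ applyUpTo (λ t → L l (t <ᵇ b))) (sym (ℕ.m+[n∸m]≡n b≤k)) ⟩
      sum (applyUpTo (λ t → L l (t <ᵇ b)) (b + c))  ≡⟨ sum-applyUpTo-<ᵇ (L l) b c ⟩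
      b * L l true + c * L l false                  ∎))
    pendants : sum (applyUpTo (λ t → F (5 * k + t)) b) ≡ b * L 5 true + c * L 5 false
    pendants = begin
      sum (applyUpTo (λ t → F (5 * k + t)) b)
        ≡⟨ sum-applyUpTo-const b (λ {t} t<b →
             trans (localSum-layer g 5 (ℕ.<-≤-trans t<b b≤k)) (cong (L 5) (dec-true (t ℕ.<? b) t<b))) ⟩
      b * L 5 true
        ≡⟨ ℕ.+-identityʳ (b * L 5 true) ⟨
      b * L 5 true + 0
        ≡⟨ cong (b * L 5 true +_) (ℕ.*-zeroʳ c) ⟨
      b * L 5 true + c * L 5 false ∎

  degreeSum-beads : ∀ g → (∀ x y → g x y ≡ g y x) → 2 * degreeSum G g ≡ b * beadSum g true + c * beadSum g false
  degreeSum-beads g g-sym = trans (degreeSum-toGraph necklace g g-sym) (localSum-total g)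

  m : ℕ
  m = 8 * b + 7 * c

  private
    k≡b+c : k ≡ b + c
    k≡b+c = sym (ℕ.m+[n∸m]≡n b≤k)

    halve : ∀ {x y} → 2 * x ≡ 2 * y → x ≡ y
    halve {x} {y} = ℕ.*-cancelˡ-≡ x y 2

  size≡m : size G ≡ m
  size≡m = halve (begin
    2 * size G                  ≡⟨ cong (2 *_) (size≡degreeSum G) ⟩
    2 * degreeSum G (λ _ _ → 1) ≡⟨ degreeSum-beads (λ _ _ → 1) (λ _ _ → refl) ⟩
    b * 16 + c * 14             ≡⟨ 16b+14c≡2[8b+7c] b c ⟩
    2 * m                       ∎)
    where
    open ≡-Reasoning
    16b+14c≡2[8b+7c] : ∀ b c → b * 16 + c * 14 ≡ 2 * (8 * b + 7 * c)
    16b+14c≡2[8b+7c] = solve-∀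

  degreeSum-* : degreeSum G _*_ ≡ 3 * 3 * size G
  degreeSum-* = halve (begin
    2 * degreeSum G _*_  ≡⟨ degreeSum-beads _*_ ℕ.*-comm ⟩
    b * 144 + c * 126    ≡⟨ 144b+126c≡2[9m] b c ⟩
    2 * (3 * 3 * m)      ≡⟨ cong (λ s → 2 * (3 * 3 * s)) size≡m ⟨
    2 * (3 * 3 * size G) ∎)
    where
    open ≡-Reasoning
    144b+126c≡2[9m] : ∀ b c → b * 144 + c * 126 ≡ 2 * (3 * 3 * (8 * b + 7 * c))
    144b+126c≡2[9m] = solve-∀

  degreeSum-+ : degreeSum G _+_ ≡ 2 * 3 * size G
  degreeSum-+ = halve (begin
    2 * degreeSum G _+_  ≡⟨ degreeSum-beads _+_ ℕ.+-comm ⟩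
    b * 96 + c * 84      ≡⟨ 96b+84c≡2[6m] b c ⟩
    2 * (2 * 3 * m)      ≡⟨ cong (λ s → 2 * (2 * 3 * s)) size≡m ⟨
    2 * (2 * 3 * size G) ∎)
    where
    open ≡-Reasoning
    96b+84c≡2[6m] : ∀ b c → b * 96 + c * 84 ≡ 2 * (2 * 3 * (8 * b + 7 * c))
    96b+84c≡2[6m] = solve-∀

  degreeSum-sumOfSquares≢ : degreeSum G sumOfSquares ≢ 2 * 3 * 3 * size G
  degreeSum-sumOfSquares≢ eq = ℕ.<⇒≢ (ℕ.<-≤-trans (s≤s z≤n) (ℕ.≤-trans 2≤k k≤excess)) (sym excess≡0)
    where
    open ≡-Reasoning
    excess : ℕ
    excess = 10 * b + 8 * c
    k≤excess : k ≤ excess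
    k≤excess = subst₂ _≤_ (sym k≡b+c) (b+c+[9b+7c]≡excess b c) (ℕ.m≤m+n (b + c) (9 * b + 7 * c))
      where
      b+c+[9b+7c]≡excess : ∀ b c → b + c + (9 * b + 7 * c) ≡ 10 * b + 8 * c
      b+c+[9b+7c]≡excess = solve-∀
    excess≡0 : excess ≡ 0
    excess≡0 = ℕ.+-cancelˡ-≡ (2 * 3 * 3 * m) excess 0 (halve (begin
      2 * (2 * 3 * 3 * m + excess)                ≡⟨ 308b+268c≡2[18m+excess] b c ⟨
      b * 308 + c * 268                           ≡⟨ degreeSum-beads sumOfSquares (λ x y → ℕ.+-comm (x * x) (y * y)) ⟨
      2 * degreeSum G sumOfSquares                ≡⟨ cong (2 *_) (trans eq (cong (2 * 3 * 3 *_) size≡m)) ⟩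
      2 * (2 * 3 * 3 * m)                         ≡⟨ cong (2 *_) (ℕ.+-identityʳ (2 * 3 * 3 * m)) ⟨
      2 * (2 * 3 * 3 * m + 0)                     ∎))
      where
      308b+268c≡2[18m+excess] : ∀ b c → b * 308 + c * 268 ≡ 2 * (2 * 3 * 3 * (8 * b + 7 * c) + (10 * b + 8 * c))
      308b+268c≡2[18m+excess] = solve-∀

  size≢0 : size G ≢ 0
  size≢0 size≡0 = ℕ.<⇒≢ (ℕ.<-≤-trans (s≤s z≤n) (ℕ.≤-trans 2≤k k≤m)) (sym (trans (sym size≡m) size≡0))
    where
    k≤m : k ≤ m
    k≤m = subst₂ _≤_ (sym k≡b+c) (b+c+[7b+6c]≡m b c) (ℕ.m≤m+n (b + c) (7 * b + 6 * c))
      where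
      b+c+[7b+6c]≡m : ∀ b c → b + c + (7 * b + 6 * c) ≡ 8 * b + 7 * c
      b+c+[7b+6c]≡m = solve-∀

  i₀ : Fin k
  i₀ = fromℕ< (ℕ.<-≤-trans (s≤s z≤n) 2≤k)

  root : ℕ
  root = code (0 , i₀)

  edge : ∀ {p q} → q ∈ nbrsAt p → code q ∈ nbrs (code p)
  edge {p} {q} q∈ = subst (code q ∈_) (sym (nbrs-code p)) (∈-map⁺ code q∈)

  toRoot : ∀ p → Valid p → Path necklace (code p) root
  toRoot (0 , i) _       = alongNecklace (toℕ i) i refl
    where
    alongNecklace : ∀ t i → toℕ i ≡ t → Path necklace (code (0 , i)) root
    alongNecklace zero    i i≡0   =
      subst (λ j → Path necklace (code (0 , j)) root) (toℕ-injective (trans (toℕ-fromℕ< _) (sym i≡0))) []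
    alongNecklace (suc t) i i≡1+t = edge {0 , i} (there (there (there (here refl))))
                                  ∷ edge {4 , prev i} (here refl)
                                  ∷ alongNecklace t (prev i) (toℕ-prev i≡1+t)
  toRoot (1 , i) _       = edge {1 , i} (here refl) ∷ toRoot (0 , i) _
  toRoot (2 , i) _       = edge {2 , i} (here refl) ∷ toRoot (1 , i) _
  toRoot (3 , i) _       = edge {3 , i} (here refl) ∷ toRoot (0 , i) _
  toRoot (4 , i) _       = edge {4 , i} (here refl) ∷ toRoot (0 , i) _
  toRoot (5 , i) pendant = edge {5 , i} (∈-listIf⁺ pendant) ∷ toRoot (3 , i) _

  connected : Connected G
  connected = connected-toGraph necklace (code-< {0 , i₀} _) λ {x} x<N →
    subst (λ y → Path necklace y root) (code-decode x) (toRoot (decode x) (<N⇒valid x<N))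

  notTree : ¬ IsTree G
  notTree (_ , acyclic) = acyclic (triangle-toGraph necklace
    (layers-≢ 0 1 (λ ())) (layers-≢ 0 4 (λ ())) (layers-≢ 1 4 (λ ()))
    (edge {0 , i₀} (here refl)) (edge {1 , i₀} (there (there (here refl)))) (edge {4 , i₀} (here refl)))
    where
    layers-≢ : ∀ l l′ → l ≢ l′ → code (l , i₀) ≢ code (l′ , i₀)
    layers-≢ l l′ l≢l′ = l≢l′ ∘ cong proj₁ ∘ code-injective

  neutral : Neutral G
  neutral = degreeSums⇒neutral G 3 size≢0 degreeSum-* degreeSum-+ degreeSum-sumOfSquares≢

theorem3 : (n : ℕ) → 38 ≤ n →
    Σ (Graph n) λ G → Connected G × ¬ IsTree G × Neutral G
theorem3 n 38≤n = subst (λ n → Σ (Graph n) λ G → Connected G × ¬ IsTree G × Neutral G) 5k+b≡n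
  (G , connected , notTree , neutral)
  where
  k b : ℕ
  k = n / 5
  b = n % 5
  7≤k : 7 ≤ k
  7≤k = /-monoˡ-≤ 5 38≤n
  b≤k : b ≤ k
  b≤k = ℕ.≤-trans (ℕ.<⇒≤pred (m%n<n n 5)) (ℕ.≤-trans (s≤s (s≤s (s≤s (s≤s z≤n)))) 7≤k)
  5k+b≡n : 5 * k + b ≡ n
  5k+b≡n = trans (ℕ.+-comm (5 * k) b) (trans (cong (b +_) (ℕ.*-comm 5 k)) (sym (m≡m%n+[m/n]*n n 5)))
  open Necklace k b (ℕ.≤-trans (s≤s (s≤s z≤n)) 7≤k) b≤k
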